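{- The cactus groups $J_3$ and $J_4$ admit the presentations $J_3\cong\langle s_{1,2},s_{1,3}\mid s_{1,2}^2=s_{1,3}^2=1\rangle\cong\mathbb{Z}_2*\mathbb{Z}_2$ and $J_4\cong\langle s_{1,2},s_{1,3},s_{1,4}\mid s_{1,2}^2=s_{1,3}^2=s_{1,4}^2=1,\ s_{1,2}s_{1,4}s_{1,2}s_{1,4}=s_{1,4}s_{1,2}s_{1,4}s_{1,2},\ s_{1,4}s_{1,3}s_{1,2}s_{1,3}=s_{1,3}s_{1,2}s_{1,3}s_{1,4}\rangle$, where the generators correspond to the generators of the same names.
   Context: For $n \ge 2$, the cactus group $J_n$ is the group with generators $s_{p,q}$ for $1 \le p < q \le n$ and relations: (j1) $s_{p,q}^2 = 1$; (j2) $s_{p,q}s_{m,r} = s_{m,r}s_{p,q}$ whenever $[p,q]\cap[m,r]=\emptyset$; (j3) $s_{p,q}s_{m,r} = s_{p+q-r,\,p+q-m}\,s_{p,q}$ whenever $[m,r]\subset[p,q]$ (intervals of integers). -}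

module Defs where

open import Data.Nat using (ℕ; zero; suc; _+_; _∸_; _≤_; _<_; z≤n; s≤s)
open import Data.Bool using (Bool; true; false; not)
open import Data.List using (List; []; _∷_; _++_; reverse; map; concat)
open import Data.Product using (_×_; _,_; Σ; ∃)
open import Data.Sum using (_⊎_)
open import Relation.Binary.PropositionalEquality using (_≡_)

-- A letter is a generator together with an exponent sign:
-- (g , false) stands for g, (g , true) stands for g⁻¹.
Letter : Set → Set
Letter G = G × Bool

Word : Set → Set
Word G = List (Letter G)

gen : {G : Set} → G → Word G
gen g = (g , false) ∷ []

invLetter : {G : Set} → Letter G → Letter G
invLetter (g , b) = (g , not b)

invWord : {G : Set} → Word G → Word G
invWord w = reverse (map invLetter w)

Relations : Set → Set₁
Relations G = Word G → Word G → Set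

data _⊢_≈_ {G : Set} (R : Relations G) : Word G → Word G → Set where
  ≈-refl  : ∀ {w} → R ⊢ w ≈ w
  ≈-sym   : ∀ {w w'} → R ⊢ w ≈ w' → R ⊢ w' ≈ w
  ≈-trans : ∀ {w w' w''} → R ⊢ w ≈ w' → R ⊢ w' ≈ w'' → R ⊢ w ≈ w''
  ≈-free  : ∀ u v (x : Letter G) →
            R ⊢ (u ++ x ∷ invLetter x ∷ v) ≈ (u ++ v)
  ≈-rel   : ∀ u v {l r} → R l r → R ⊢ (u ++ l ++ v) ≈ (u ++ r ++ v)

substLetter : {G H : Set} → (G → Word H) → Letter G → Word H
substLetter f (g , false) = f g
substLetter f (g , true)  = invWord (f g)

subst : {G H : Set} → (G → Word H) → Word G → Word H
subst f w = concat (map (substLetter f) w)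

IsHom : {G H : Set} (R : Relations G) (S : Relations H) → (G → Word H) → Set
IsHom R S ψ = ∀ {w w'} → R ⊢ w ≈ w' → S ⊢ subst ψ w ≈ subst ψ w'

IsIsoVia : {G H : Set} (R : Relations G) (S : Relations H) → (G → Word H) → Set
IsIsoVia {G} {H} R S ψ =
  IsHom R S ψ ×
  Σ (H → Word G) (λ φ →
     IsHom S R φ ×
     (∀ w → R ⊢ subst φ (subst ψ w) ≈ w) ×
     (∀ w → S ⊢ subst ψ (subst φ w) ≈ w))

record JGen (n : ℕ) : Set where
  constructor s[_,_]⟨_,_,_⟩
  field
    p q   : ℕ
    1≤p   : 1 ≤ p
    p<q   : p < q
    q≤n   : q ≤ n
open JGen public

data JRel (n : ℕ) : Relations (JGen n) where
  j1 : ∀ (a : JGen n) → JRel n (gen a ++ gen a) []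
  j2 : ∀ (a b : JGen n) → (q a < p b ⊎ q b < p a) →
       JRel n (gen a ++ gen b) (gen b ++ gen a)
  j3 : ∀ (a b c : JGen n) → p a ≤ p b → q b ≤ q a →
       p c ≡ p a + q a ∸ q b → q c ≡ p a + q a ∸ p b →
       JRel n (gen a ++ gen b) (gen c ++ gen a)

data Gen3 : Set where
  t12 t13 : Gen3

data Rel3 : Relations Gen3 where
  sq : ∀ g → Rel3 (gen g ++ gen g) []

data Gen4 : Set where
  u12 u13 u14 : Gen4

data Rel4 : Relations Gen4 where
  sq  : ∀ g → Rel4 (gen g ++ gen g) []
  r1  : Rel4 (gen u12 ++ gen u14 ++ gen u12 ++ gen u14)
             (gen u14 ++ gen u12 ++ gen u14 ++ gen u12)
  r2  : Rel4 (gen u14 ++ gen u13 ++ gen u12 ++ gen u13)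
             (gen u13 ++ gen u12 ++ gen u13 ++ gen u14)

s12-3 s13-3 : JGen 3
s12-3 = s[ 1 , 2 ]⟨ s≤s z≤n , s≤s (s≤s z≤n) , s≤s (s≤s z≤n) ⟩
s13-3 = s[ 1 , 3 ]⟨ s≤s z≤n , s≤s (s≤s z≤n) , s≤s (s≤s (s≤s z≤n)) ⟩

ψ3 : Gen3 → Word (JGen 3)
ψ3 t12 = gen s12-3
ψ3 t13 = gen s13-3

s12-4 s13-4 s14-4 : JGen 4
s12-4 = s[ 1 , 2 ]⟨ s≤s z≤n , s≤s (s≤s z≤n) , s≤s (s≤s z≤n) ⟩
s13-4 = s[ 1 , 3 ]⟨ s≤s z≤n , s≤s (s≤s z≤n) , s≤s (s≤s (s≤s z≤n)) ⟩
s14-4 = s[ 1 , 4 ]⟨ s≤s z≤n , s≤s (s≤s z≤n) , s≤s (s≤s (s≤s (s≤s z≤n))) ⟩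

ψ4 : Gen4 → Word (JGen 4)
ψ4 u12 = gen s12-4
ψ4 u13 = gen s13-4
ψ4 u14 = gen s14-4

{-# OPTIONS --safe #-}
-- Every s₍p,q₎ is, by (j3), the conjugate s₍1,r₎ s₍1+r−q,1+r−p₎ s₍1,r₎ of a
-- generator s₍1,m₎, so the generators s₍1,q₎ suffice and this formula gives the
-- inverse map. A map of generators respecting the defining relations induces a
-- homomorphism of presented groups, and two such maps that are inverse on
-- generators are inverse isomorphisms. It remains to check the finitely many
-- cactus relations of J₃ and J₄ on the conjugate words; the two extra relations
-- of J₄ are (j2) for s₁₂, s₃₄ and (j3) for s₁₄, s₂₃, rewritten through
-- s₃₄ = s₁₄ s₁₂ s₁₄ and s₂₃ = s₁₃ s₁₂ s₁₃.

module Submission where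

open import Defs
open import Data.Bool using (false; true)
open import Data.List using ([]; _∷_; _++_; map; reverse)
open import Data.List.Properties using (++-assoc; ++-identityʳ; map-++; reverse-++; unfold-reverse)
open import Data.Nat using (ℕ; _+_; _∸_; _≤_; _<_; _≤?_; z≤n; s≤s)
open import Data.Nat.Properties using (≤-irrelevant)
open import Data.Product using (_×_; _,_)
open import Data.Empty using (⊥-elim)
open import Data.Sum using (inj₁; inj₂)
open import Level using (0ℓ)
open import Relation.Binary.Bundles using (Setoid)
open import Relation.Binary.PropositionalEquality using (_≡_; refl; sym; trans; cong; cong₂; subst₂; module ≡-Reasoning)
open import Relation.Nullary using (¬_)
open import Relation.Nullary.Decidable using (True; toWitness)

invWord-∷ : ∀ {G : Set} (x : Letter G) w → invWord (x ∷ w) ≡ invWord w ++ invLetter x ∷ []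
invWord-∷ x w = unfold-reverse (invLetter x) (map invLetter w)

invLetter-involutive : ∀ {G : Set} (x : Letter G) → invLetter (invLetter x) ≡ x
invLetter-involutive (g , false) = refl
invLetter-involutive (g , true) = refl

invWord-++ : ∀ {G : Set} (u v : Word G) → invWord (u ++ v) ≡ invWord v ++ invWord u
invWord-++ u v = trans (cong reverse (map-++ invLetter u v)) (reverse-++ (map invLetter u) (map invLetter v))

invWord-involutive : ∀ {G : Set} (w : Word G) → invWord (invWord w) ≡ w
invWord-involutive [] = refl
invWord-involutive (x ∷ w) = begin
  invWord (invWord (x ∷ w))                     ≡⟨ cong invWord (invWord-∷ x w) ⟩
  invWord (invWord w ++ invLetter x ∷ [])        ≡⟨ invWord-++ (invWord w) (invLetter x ∷ []) ⟩
  invLetter (invLetter x) ∷ invWord (invWord w) ≡⟨ cong₂ _∷_ (invLetter-involutive x) (invWord-involutive w) ⟩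
  x ∷ w                                         ∎
  where open ≡-Reasoning

-- Words modulo a presentation

module _ {G : Set} {R : Relations G} where

  ≈-reflexive : ∀ {w w′} → w ≡ w′ → R ⊢ w ≈ w′
  ≈-reflexive refl = ≈-refl

  ≈-context : ∀ u v {w w′} → R ⊢ w ≈ w′ → R ⊢ (u ++ w ++ v) ≈ (u ++ w′ ++ v)
  ≈-context u v ≈-refl = ≈-refl
  ≈-context u v (≈-sym p) = ≈-sym (≈-context u v p)
  ≈-context u v (≈-trans p q) = ≈-trans (≈-context u v p) (≈-context u v q)
  ≈-context u v (≈-free u′ v′ x) =
    subst₂ (R ⊢_≈_) (reassoc (x ∷ invLetter x ∷ v′)) (reassoc v′) (≈-free (u ++ u′) (v′ ++ v) x)
    where
      reassoc : ∀ m → (u ++ u′) ++ m ++ v ≡ u ++ (u′ ++ m) ++ v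
      reassoc m = trans (++-assoc u u′ (m ++ v)) (cong (u ++_) (sym (++-assoc u′ m v)))
  ≈-context u v (≈-rel u′ v′ {l} {r} h) =
    subst₂ (R ⊢_≈_) (reassoc l) (reassoc r) (≈-rel (u ++ u′) (v′ ++ v) h)
    where
      reassoc : ∀ m → (u ++ u′) ++ m ++ v′ ++ v ≡ u ++ (u′ ++ m ++ v′) ++ v
      reassoc m = trans (++-assoc u u′ (m ++ v′ ++ v))
        (cong (u ++_) (trans (cong (u′ ++_) (sym (++-assoc m v′ v)))
                             (sym (++-assoc u′ (m ++ v′) v))))

  ≈-++ : ∀ {w₁ w₁′ w₂ w₂′} → R ⊢ w₁ ≈ w₁′ → R ⊢ w₂ ≈ w₂′ → R ⊢ (w₁ ++ w₂) ≈ (w₁′ ++ w₂′)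
  ≈-++ {w₁′ = w₁′} {w₂} {w₂′} p q = ≈-trans (≈-context [] w₂ p)
    (subst₂ (R ⊢_≈_) (cong (w₁′ ++_) (++-identityʳ w₂)) (cong (w₁′ ++_) (++-identityʳ w₂′))
      (≈-context w₁′ [] q))

  ≈-inverseʳ : ∀ w → R ⊢ (w ++ invWord w) ≈ []
  ≈-inverseʳ [] = ≈-refl
  ≈-inverseʳ (x ∷ w) = ≈-trans (≈-reflexive (cong (x ∷_) regroup))
    (≈-trans (≈-context (x ∷ []) (invLetter x ∷ []) (≈-inverseʳ w)) (≈-free [] [] x))
    where
      regroup : w ++ invWord (x ∷ w) ≡ (w ++ invWord w) ++ invLetter x ∷ []
      regroup = trans (cong (w ++_) (invWord-∷ x w)) (sym (++-assoc w (invWord w) _))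

  ≈-inverseˡ : ∀ w → R ⊢ (invWord w ++ w) ≈ []
  ≈-inverseˡ w =
    subst₂ (R ⊢_≈_) (cong (invWord w ++_) (invWord-involutive w)) refl (≈-inverseʳ (invWord w))

⊢-setoid : {G : Set} → Relations G → Setoid 0ℓ 0ℓ
⊢-setoid {G} R = record
  { Carrier = Word G
  ; _≈_ = R ⊢_≈_
  ; isEquivalence = record { refl = ≈-refl ; sym = ≈-sym ; trans = ≈-trans }
  }

module _ {G H : Set} (f : G → Word H) where

  subst-++ : ∀ u v → subst f (u ++ v) ≡ subst f u ++ subst f v
  subst-++ [] v = refl
  subst-++ (x ∷ u) v = trans (cong (substLetter f x ++_) (subst-++ u v)) (sym (++-assoc (substLetter f x) _ _))

  subst-gen-++-gen : ∀ a b → subst f (gen a ++ gen b) ≡ f a ++ f b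
  subst-gen-++-gen a b = cong (f a ++_) (++-identityʳ (f b))

  ≈-subst-gen-++-gen : ∀ {S : Relations H} a b c d → S ⊢ (f a ++ f b) ≈ (f c ++ f d) →
    S ⊢ subst f (gen a ++ gen b) ≈ subst f (gen c ++ gen d)
  ≈-subst-gen-++-gen {S} a b c d =
    subst₂ (S ⊢_≈_) (sym (subst-gen-++-gen a b)) (sym (subst-gen-++-gen c d))

  substLetter-invLetter : ∀ x → substLetter f (invLetter x) ≡ invWord (substLetter f x)
  substLetter-invLetter (g , false) = refl
  substLetter-invLetter (g , true) = sym (invWord-involutive (f g))

  subst-invWord : ∀ w → subst f (invWord w) ≡ invWord (subst f w)
  subst-invWord [] = refl
  subst-invWord (x ∷ w) = begin
    subst f (invWord (x ∷ w))                              ≡⟨ cong (subst f) (invWord-∷ x w) ⟩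
    subst f (invWord w ++ invLetter x ∷ [])                 ≡⟨ subst-++ (invWord w) (invLetter x ∷ []) ⟩
    subst f (invWord w) ++ substLetter f (invLetter x) ++ [] ≡⟨ cong₂ _++_ (subst-invWord w) (++-identityʳ _) ⟩
    invWord (subst f w) ++ substLetter f (invLetter x)       ≡⟨ cong (invWord (subst f w) ++_) (substLetter-invLetter x) ⟩
    invWord (subst f w) ++ invWord (substLetter f x)         ≡⟨ invWord-++ (substLetter f x) (subst f w) ⟨
    invWord (subst f (x ∷ w))                              ∎
    where open ≡-Reasoning

subst-subst : ∀ {G H K : Set} (f : G → Word H) (g : H → Word K) w →
  subst g (subst f w) ≡ subst (λ x → subst g (f x)) w
subst-subst f g [] = refl
subst-subst f g ((x , b) ∷ w) =
  trans (subst-++ g (substLetter f (x , b)) (subst f w)) (cong₂ _++_ (letter b) (subst-subst f g w))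
  where
    letter : ∀ b → subst g (substLetter f (x , b)) ≡ substLetter (λ y → subst g (f y)) (x , b)
    letter false = refl
    letter true = subst-invWord g (f x)

Respects : {G H : Set} (R : Relations G) (S : Relations H) → (G → Word H) → Set
Respects R S ψ = ∀ {l r} → R l r → S ⊢ subst ψ l ≈ subst ψ r

respects⇒isHom : ∀ {G H : Set} {R : Relations G} {S : Relations H} (ψ : G → Word H) →
  Respects R S ψ → IsHom R S ψ
respects⇒isHom ψ h ≈-refl = ≈-refl
respects⇒isHom ψ h (≈-sym p) = ≈-sym (respects⇒isHom ψ h p)
respects⇒isHom ψ h (≈-trans p q) = ≈-trans (respects⇒isHom ψ h p) (respects⇒isHom ψ h q)
respects⇒isHom {S = S} ψ h (≈-free u v x) =
  subst₂ (S ⊢_≈_) (sym (subst-++ ψ u _)) (sym (subst-++ ψ u v)) (≈-++ ≈-refl cancel)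
  where
    cancel : S ⊢ subst ψ (x ∷ invLetter x ∷ v) ≈ subst ψ v
    cancel = begin
      substLetter ψ x ++ substLetter ψ (invLetter x) ++ subst ψ v
        ≡⟨ cong (λ y → substLetter ψ x ++ y ++ subst ψ v) (substLetter-invLetter ψ x) ⟩
      substLetter ψ x ++ invWord (substLetter ψ x) ++ subst ψ v
        ≡⟨ ++-assoc (substLetter ψ x) (invWord (substLetter ψ x)) (subst ψ v) ⟨
      (substLetter ψ x ++ invWord (substLetter ψ x)) ++ subst ψ v
        ≈⟨ ≈-++ (≈-inverseʳ (substLetter ψ x)) ≈-refl ⟩
      subst ψ v ∎
      where open import Relation.Binary.Reasoning.Setoid (⊢-setoid S)
respects⇒isHom {S = S} ψ h (≈-rel u v {l} {r} p) =
  subst₂ (S ⊢_≈_) (distribute l) (distribute r) (≈-context (subst ψ u) (subst ψ v) (h p))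
  where
    distribute : ∀ m → subst ψ u ++ subst ψ m ++ subst ψ v ≡ subst ψ (u ++ m ++ v)
    distribute m = sym (trans (subst-++ ψ u (m ++ v)) (cong (subst ψ u ++_) (subst-++ ψ m v)))

subst-≈-id : ∀ {G : Set} {R : Relations G} (f : G → Word G) →
  (∀ g → R ⊢ f g ≈ gen g) → ∀ w → R ⊢ subst f w ≈ w
subst-≈-id f fixes [] = ≈-refl
subst-≈-id {R = R} f fixes (x ∷ w) = ≈-++ (letter x) (subst-≈-id f fixes w)
  where
    letter : ∀ x → R ⊢ substLetter f x ≈ (x ∷ [])
    letter (g , false) = fixes g
    letter (g , true) = begin
      invWord (f g)                           ≡⟨ ++-identityʳ _ ⟨
      invWord (f g) ++ []                     ≈⟨ ≈-context (invWord (f g)) [] (≈-free [] [] (g , false)) ⟨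
      invWord (f g) ++ gen g ++ (g , true) ∷ [] ≈⟨ ≈-context (invWord (f g)) ((g , true) ∷ []) (fixes g) ⟨
      invWord (f g) ++ f g ++ (g , true) ∷ []   ≡⟨ ++-assoc (invWord (f g)) (f g) _ ⟨
      (invWord (f g) ++ f g) ++ (g , true) ∷ [] ≈⟨ ≈-context [] ((g , true) ∷ []) (≈-inverseˡ (f g)) ⟩
      (g , true) ∷ []                         ∎
      where open import Relation.Binary.Reasoning.Setoid (⊢-setoid R)

isIsoVia-fromGenerators : ∀ {G H : Set} {R : Relations G} {S : Relations H}
  (ψ : G → Word H) (φ : H → Word G) → Respects R S ψ → Respects S R φ →
  (∀ g → R ⊢ subst φ (ψ g) ≈ gen g) → (∀ h → S ⊢ subst ψ (φ h) ≈ gen h) → IsIsoVia R S ψ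
isIsoVia-fromGenerators ψ φ ψ-resp φ-resp φψ≈id ψφ≈id =
  respects⇒isHom ψ ψ-resp , φ , respects⇒isHom φ φ-resp , inverse ψ φ φψ≈id , inverse φ ψ ψφ≈id
  where
    inverse : ∀ {A B : Set} {T : Relations A} (α : A → Word B) (β : B → Word A) →
      (∀ a → T ⊢ subst β (α a) ≈ gen a) → ∀ w → T ⊢ subst β (subst α w) ≈ w
    inverse {T = T} α β βα≈id w =
      subst₂ (T ⊢_≈_) (sym (subst-subst α β w)) refl (subst-≈-id _ βα≈id w)

≤-evident : ∀ {m n} {m≤n : True (m ≤? n)} → m ≤ n
≤-evident {m≤n = m≤n} = toWitness m≤n

JGen-≡ : ∀ {n} {a b : JGen n} → p a ≡ p b → q a ≡ q b → a ≡ b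
JGen-≡ {a = s[ _ , _ ]⟨ x , y , z ⟩} {s[ _ , _ ]⟨ x′ , y′ , z′ ⟩} refl refl
  rewrite ≤-irrelevant x x′ | ≤-irrelevant y y′ | ≤-irrelevant z z′ = refl

j3-conjugate : ∀ {n} (a b c : JGen n) → p a ≤ p b → q b ≤ q a →
  p c ≡ p a + q a ∸ q b → q c ≡ p a + q a ∸ p b → JRel n ⊢ (gen a ++ gen b ++ gen a) ≈ gen c
j3-conjugate a b c pa≤pb qb≤qa pc≡ qc≡ =
  ≈-trans (≈-rel [] (gen a) (j3 a b c pa≤pb qb≤qa pc≡ qc≡)) (≈-rel (gen c) [] (j1 a))

-- J₃

data Interval3 : ℕ → ℕ → Set where
  [1,2] : Interval3 1 2
  [1,3] : Interval3 1 3
  [2,3] : Interval3 2 3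

-- Matching on the proofs of 1 ≤ p < q ≤ n pins down p and q.
view3 : (a : JGen 3) → Interval3 (p a) (q a)
view3 s[ _ , _ ]⟨ s≤s z≤n , s≤s (s≤s z≤n) , s≤s (s≤s z≤n) ⟩ = [1,2]
view3 s[ _ , _ ]⟨ s≤s z≤n , s≤s (s≤s z≤n) , s≤s (s≤s (s≤s z≤n)) ⟩ = [1,3]
view3 s[ _ , _ ]⟨ s≤s z≤n , s≤s (s≤s (s≤s z≤n)) , s≤s (s≤s (s≤s z≤n)) ⟩ = [2,3]

word3 : ∀ {p q} → Interval3 p q → Word Gen3
word3 [1,2] = gen t12
word3 [1,3] = gen t13
word3 [2,3] = gen t13 ++ gen t12 ++ gen t13

φ3 : JGen 3 → Word Gen3
φ3 a = word3 (view3 a)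

square3 : ∀ u v g → Rel3 ⊢ (u ++ gen g ++ gen g ++ v) ≈ (u ++ v)
square3 u v g = ≈-rel u v (sq g)

word3-involutive : ∀ {p q} (i : Interval3 p q) → Rel3 ⊢ (word3 i ++ word3 i) ≈ []
word3-involutive [1,2] = square3 [] [] t12
word3-involutive [1,3] = square3 [] [] t13
word3-involutive [2,3] = ≈-trans (square3 (gen t13 ++ gen t12) (gen t12 ++ gen t13) t13)
  (≈-trans (square3 (gen t13) (gen t13) t12) (square3 [] [] t13))

Interval3-overlap : ∀ {pa qa pb qb} → Interval3 pa qa → Interval3 pb qb → ¬ (qa < pb)
Interval3-overlap [1,2] () (s≤s (s≤s (s≤s _)))
Interval3-overlap [1,3] () (s≤s (s≤s (s≤s _)))
Interval3-overlap [2,3] () (s≤s (s≤s (s≤s _)))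

-- No nesting hypothesis is needed: for a non-nested pair a, b the reflected
-- interval c is not an interval of J₃.
word3-nested : ∀ {pa qa pb qb} (a : Interval3 pa qa) (b : Interval3 pb qb)
  (c : Interval3 (pa + qa ∸ qb) (pa + qa ∸ pb)) →
  Rel3 ⊢ (word3 a ++ word3 b) ≈ (word3 c ++ word3 a)
word3-nested [1,2] [1,2] [1,2] = ≈-refl
word3-nested [1,3] [1,2] [2,3] = ≈-sym (square3 (gen t13 ++ gen t12) [] t13)
word3-nested [1,3] [1,3] [1,3] = ≈-refl
word3-nested [1,3] [2,3] [1,2] = square3 [] (gen t12 ++ gen t13) t13
word3-nested [2,3] [2,3] [2,3] = ≈-refl

φ3-respects : Respects (JRel 3) Rel3 φ3
φ3-respects (j1 a) = ≈-trans (≈-reflexive (subst-gen-++-gen φ3 a a)) (word3-involutive (view3 a))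
φ3-respects (j2 a b (inj₁ qa<pb)) = ⊥-elim (Interval3-overlap (view3 a) (view3 b) qa<pb)
φ3-respects (j2 a b (inj₂ qb<pa)) = ⊥-elim (Interval3-overlap (view3 b) (view3 a) qb<pa)
φ3-respects (j3 a b c@(s[ _ , _ ]⟨ _ , _ , _ ⟩) _ _ refl refl) =
  ≈-subst-gen-++-gen φ3 a b c a (word3-nested (view3 a) (view3 b) (view3 c))

ψ3-respects : Respects Rel3 (JRel 3) ψ3
ψ3-respects (sq t12) = ≈-rel [] [] (j1 s12-3)
ψ3-respects (sq t13) = ≈-rel [] [] (j1 s13-3)

φ3∘ψ3≈gen : ∀ g → Rel3 ⊢ subst φ3 (ψ3 g) ≈ gen g
φ3∘ψ3≈gen t12 = ≈-refl
φ3∘ψ3≈gen t13 = ≈-refl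

ψ3∘φ3≈gen : ∀ a → JRel 3 ⊢ subst ψ3 (φ3 a) ≈ gen a
ψ3∘φ3≈gen a@(s[ _ , _ ]⟨ _ , _ , _ ⟩) = ψ3-word3 (view3 a)
  where
    ψ3-word3 : ∀ {p q x y z} (i : Interval3 p q) → JRel 3 ⊢ subst ψ3 (word3 i) ≈ gen s[ p , q ]⟨ x , y , z ⟩
    ψ3-word3 [1,2] = ≈-reflexive (cong gen (JGen-≡ refl refl))
    ψ3-word3 [1,3] = ≈-reflexive (cong gen (JGen-≡ refl refl))
    ψ3-word3 [2,3] = j3-conjugate s13-3 s12-3 _ ≤-evident ≤-evident refl refl

-- J₄

data Interval4 : ℕ → ℕ → Set where
  [1,2] : Interval4 1 2
  [1,3] : Interval4 1 3
  [1,4] : Interval4 1 4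
  [2,3] : Interval4 2 3
  [2,4] : Interval4 2 4
  [3,4] : Interval4 3 4

view4 : (a : JGen 4) → Interval4 (p a) (q a)
view4 s[ _ , _ ]⟨ s≤s z≤n , s≤s (s≤s z≤n) , s≤s (s≤s z≤n) ⟩ = [1,2]
view4 s[ _ , _ ]⟨ s≤s z≤n , s≤s (s≤s z≤n) , s≤s (s≤s (s≤s z≤n)) ⟩ = [1,3]
view4 s[ _ , _ ]⟨ s≤s z≤n , s≤s (s≤s z≤n) , s≤s (s≤s (s≤s (s≤s z≤n))) ⟩ = [1,4]
view4 s[ _ , _ ]⟨ s≤s z≤n , s≤s (s≤s (s≤s z≤n)) , s≤s (s≤s (s≤s z≤n)) ⟩ = [2,3]
view4 s[ _ , _ ]⟨ s≤s z≤n , s≤s (s≤s (s≤s z≤n)) , s≤s (s≤s (s≤s (s≤s z≤n))) ⟩ = [2,4]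
view4 s[ _ , _ ]⟨ s≤s z≤n , s≤s (s≤s (s≤s (s≤s z≤n))) , s≤s (s≤s (s≤s (s≤s z≤n))) ⟩ = [3,4]

word4 : ∀ {p q} → Interval4 p q → Word Gen4
word4 [1,2] = gen u12
word4 [1,3] = gen u13
word4 [1,4] = gen u14
word4 [2,3] = gen u13 ++ gen u12 ++ gen u13
word4 [2,4] = gen u14 ++ gen u13 ++ gen u14
word4 [3,4] = gen u14 ++ gen u12 ++ gen u14

φ4 : JGen 4 → Word Gen4
φ4 a = word4 (view4 a)

square4 : ∀ u v g → Rel4 ⊢ (u ++ gen g ++ gen g ++ v) ≈ (u ++ v)
square4 u v g = ≈-rel u v (sq g)

conjugate-involutive4 : ∀ g h → Rel4 ⊢ ((gen g ++ gen h ++ gen g) ++ gen g ++ gen h ++ gen g) ≈ []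
conjugate-involutive4 g h = ≈-trans (square4 (gen g ++ gen h) (gen h ++ gen g) g)
  (≈-trans (square4 (gen g) (gen g) h) (square4 [] [] g))

word4-involutive : ∀ {p q} (i : Interval4 p q) → Rel4 ⊢ (word4 i ++ word4 i) ≈ []
word4-involutive [1,2] = square4 [] [] u12
word4-involutive [1,3] = square4 [] [] u13
word4-involutive [1,4] = square4 [] [] u14
word4-involutive [2,3] = conjugate-involutive4 u13 u12
word4-involutive [2,4] = conjugate-involutive4 u14 u13
word4-involutive [3,4] = conjugate-involutive4 u14 u12

word4-disjoint : ∀ {pa qa pb qb} (a : Interval4 pa qa) (b : Interval4 pb qb) → qa < pb →
  Rel4 ⊢ (word4 a ++ word4 b) ≈ (word4 b ++ word4 a)
word4-disjoint [1,2] [3,4] (s≤s (s≤s (s≤s _))) = ≈-rel [] [] r1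
word4-disjoint [1,3] () (s≤s (s≤s (s≤s (s≤s _))))
word4-disjoint [1,4] () (s≤s (s≤s (s≤s (s≤s _))))
word4-disjoint [2,3] () (s≤s (s≤s (s≤s (s≤s _))))
word4-disjoint [2,4] () (s≤s (s≤s (s≤s (s≤s _))))
word4-disjoint [3,4] () (s≤s (s≤s (s≤s (s≤s _))))

-- Except for a = [2,3], the reflected interval c of a non-nested pair a, b is
-- not an interval of J₄.
word4-nested : ∀ {pa qa pb qb} (a : Interval4 pa qa) (b : Interval4 pb qb)
  (c : Interval4 (pa + qa ∸ qb) (pa + qa ∸ pb)) → pa ≤ pb → qb ≤ qa →
  Rel4 ⊢ (word4 a ++ word4 b) ≈ (word4 c ++ word4 a)
word4-nested [1,2] [1,2] [1,2] _ _ = ≈-refl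
word4-nested [1,3] [1,2] [2,3] _ _ = ≈-sym (square4 (gen u13 ++ gen u12) [] u13)
word4-nested [1,3] [1,3] [1,3] _ _ = ≈-refl
word4-nested [1,3] [2,3] [1,2] _ _ = square4 [] (gen u12 ++ gen u13) u13
word4-nested [1,4] [1,2] [3,4] _ _ = ≈-sym (square4 (gen u14 ++ gen u12) [] u14)
word4-nested [1,4] [1,3] [2,4] _ _ = ≈-sym (square4 (gen u14 ++ gen u13) [] u14)
word4-nested [1,4] [1,4] [1,4] _ _ = ≈-refl
word4-nested [1,4] [2,3] [2,3] _ _ = ≈-rel [] [] r2
word4-nested [1,4] [2,4] [1,3] _ _ = square4 [] (gen u13 ++ gen u14) u14
word4-nested [1,4] [3,4] [1,2] _ _ = square4 [] (gen u12 ++ gen u14) u14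
word4-nested [2,3] [1,2] _ (s≤s ()) _
word4-nested [2,3] [1,3] _ (s≤s ()) _
word4-nested [2,3] [1,4] _ (s≤s ()) _
word4-nested [2,3] [2,3] [2,3] _ _ = ≈-refl
word4-nested [2,3] [2,4] _ _ (s≤s (s≤s (s≤s ())))
word4-nested [2,3] [3,4] _ _ (s≤s (s≤s (s≤s ())))
word4-nested [2,4] [2,3] [3,4] _ _ = begin
  gen u14 ++ gen u13 ++ gen u14 ++ gen u13 ++ gen u12 ++ gen u13
    ≈⟨ ≈-rel (gen u14 ++ gen u13) [] r2 ⟩
  gen u14 ++ gen u13 ++ gen u13 ++ gen u12 ++ gen u13 ++ gen u14
    ≈⟨ square4 (gen u14) (gen u12 ++ gen u13 ++ gen u14) u13 ⟩
  gen u14 ++ gen u12 ++ gen u13 ++ gen u14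
    ≈⟨ square4 (gen u14 ++ gen u12) (gen u13 ++ gen u14) u14 ⟨
  gen u14 ++ gen u12 ++ gen u14 ++ gen u14 ++ gen u13 ++ gen u14 ∎
  where open import Relation.Binary.Reasoning.Setoid (⊢-setoid Rel4)
word4-nested [2,4] [2,4] [2,4] _ _ = ≈-refl
word4-nested [2,4] [3,4] [2,3] _ _ = begin
  gen u14 ++ gen u13 ++ gen u14 ++ gen u14 ++ gen u12 ++ gen u14
    ≈⟨ square4 (gen u14 ++ gen u13) (gen u12 ++ gen u14) u14 ⟩
  gen u14 ++ gen u13 ++ gen u12 ++ gen u14
    ≈⟨ square4 (gen u14 ++ gen u13 ++ gen u12) (gen u14) u13 ⟨
  gen u14 ++ gen u13 ++ gen u12 ++ gen u13 ++ gen u13 ++ gen u14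
    ≈⟨ ≈-rel [] (gen u13 ++ gen u14) r2 ⟩
  gen u13 ++ gen u12 ++ gen u13 ++ gen u14 ++ gen u13 ++ gen u14 ∎
  where open import Relation.Binary.Reasoning.Setoid (⊢-setoid Rel4)
word4-nested [3,4] [3,4] [3,4] _ _ = ≈-refl

φ4-respects : Respects (JRel 4) Rel4 φ4
φ4-respects (j1 a) = ≈-trans (≈-reflexive (subst-gen-++-gen φ4 a a)) (word4-involutive (view4 a))
φ4-respects (j2 a b (inj₁ qa<pb)) = ≈-subst-gen-++-gen φ4 a b b a (word4-disjoint (view4 a) (view4 b) qa<pb)
φ4-respects (j2 a b (inj₂ qb<pa)) =
  ≈-subst-gen-++-gen φ4 a b b a (≈-sym (word4-disjoint (view4 b) (view4 a) qb<pa))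
φ4-respects (j3 a b c@(s[ _ , _ ]⟨ _ , _ , _ ⟩) pa≤pb qb≤qa refl refl) =
  ≈-subst-gen-++-gen φ4 a b c a (word4-nested (view4 a) (view4 b) (view4 c) pa≤pb qb≤qa)

s23-4 s34-4 : JGen 4
s23-4 = s[ 2 , 3 ]⟨ ≤-evident , ≤-evident , ≤-evident ⟩
s34-4 = s[ 3 , 4 ]⟨ ≤-evident , ≤-evident , ≤-evident ⟩

ψ4-respects : Respects Rel4 (JRel 4) ψ4
ψ4-respects (sq u12) = ≈-rel [] [] (j1 s12-4)
ψ4-respects (sq u13) = ≈-rel [] [] (j1 s13-4)
ψ4-respects (sq u14) = ≈-rel [] [] (j1 s14-4)
ψ4-respects r1 = begin
  gen s12-4 ++ gen s14-4 ++ gen s12-4 ++ gen s14-4 ≈⟨ ≈-context (gen s12-4) [] s₃₄ ⟩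
  gen s12-4 ++ gen s34-4                           ≈⟨ ≈-rel [] [] (j2 s12-4 s34-4 (inj₁ ≤-evident)) ⟩
  gen s34-4 ++ gen s12-4                           ≈⟨ ≈-context [] (gen s12-4) s₃₄ ⟨
  gen s14-4 ++ gen s12-4 ++ gen s14-4 ++ gen s12-4 ∎
  where
    open import Relation.Binary.Reasoning.Setoid (⊢-setoid (JRel 4))
    s₃₄ : JRel 4 ⊢ (gen s14-4 ++ gen s12-4 ++ gen s14-4) ≈ gen s34-4
    s₃₄ = j3-conjugate s14-4 s12-4 s34-4 ≤-evident ≤-evident refl refl
ψ4-respects r2 = begin
  gen s14-4 ++ gen s13-4 ++ gen s12-4 ++ gen s13-4 ≈⟨ ≈-context (gen s14-4) [] s₂₃ ⟩
  gen s14-4 ++ gen s23-4                           ≈⟨ ≈-rel [] [] (j3 s14-4 s23-4 s23-4 ≤-evident ≤-evident refl refl) ⟩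
  gen s23-4 ++ gen s14-4                           ≈⟨ ≈-context [] (gen s14-4) s₂₃ ⟨
  gen s13-4 ++ gen s12-4 ++ gen s13-4 ++ gen s14-4 ∎
  where
    open import Relation.Binary.Reasoning.Setoid (⊢-setoid (JRel 4))
    s₂₃ : JRel 4 ⊢ (gen s13-4 ++ gen s12-4 ++ gen s13-4) ≈ gen s23-4
    s₂₃ = j3-conjugate s13-4 s12-4 s23-4 ≤-evident ≤-evident refl refl

φ4∘ψ4≈gen : ∀ g → Rel4 ⊢ subst φ4 (ψ4 g) ≈ gen g
φ4∘ψ4≈gen u12 = ≈-refl
φ4∘ψ4≈gen u13 = ≈-refl
φ4∘ψ4≈gen u14 = ≈-refl

ψ4∘φ4≈gen : ∀ a → JRel 4 ⊢ subst ψ4 (φ4 a) ≈ gen a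
ψ4∘φ4≈gen a@(s[ _ , _ ]⟨ _ , _ , _ ⟩) = ψ4-word4 (view4 a)
  where
    ψ4-word4 : ∀ {p q x y z} (i : Interval4 p q) → JRel 4 ⊢ subst ψ4 (word4 i) ≈ gen s[ p , q ]⟨ x , y , z ⟩
    ψ4-word4 [1,2] = ≈-reflexive (cong gen (JGen-≡ refl refl))
    ψ4-word4 [1,3] = ≈-reflexive (cong gen (JGen-≡ refl refl))
    ψ4-word4 [1,4] = ≈-reflexive (cong gen (JGen-≡ refl refl))
    ψ4-word4 [2,3] = j3-conjugate s13-4 s12-4 _ ≤-evident ≤-evident refl refl
    ψ4-word4 [2,4] = j3-conjugate s14-4 s13-4 _ ≤-evident ≤-evident refl refl
    ψ4-word4 [3,4] = j3-conjugate s14-4 s12-4 _ ≤-evident ≤-evident refl refl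

propositionA1 : IsIsoVia Rel3 (JRel 3) ψ3 × IsIsoVia Rel4 (JRel 4) ψ4
propositionA1 =
  isIsoVia-fromGenerators ψ3 φ3 ψ3-respects φ3-respects φ3∘ψ3≈gen ψ3∘φ3≈gen ,
  isIsoVia-fromGenerators ψ4 φ4 ψ4-respects φ4-respects φ4∘ψ4≈gen ψ4∘φ4≈gen
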